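{- If $n\ge 3$ is odd, then $\Psi(F_n)\le \beta(F_n)+(n+1)/2$, and $\beta(F_n)+(n+1)/2=n/2+o(n)$ as $n\to\infty$ through odd integers. If $n\ge 2$ is even, then $\Psi(F_n)\le \beta(F_n)+n-1$, and $\beta(F_n)+n-1=n+o(n)$ as $n\to\infty$ through even integers.
   Context: For $u\in\{0,1\}^n$, $\overline{u}=u+(1,\dots,1)\pmod 2$. The folded hypercube $F_n$ has vertex set $\{\{u,\overline{u}\}:u\in\{0,1\}^n\}$, with $\{u,\overline u\}$ adjacent to $\{v,\overline v\}$ iff $u$ and $v$, or $u$ and $\overline v$, differ in exactly one coordinate. For a graph $G$: $S\subseteq V(G)$ is resolving if for all distinct $u,v$ some $y\in S$ has $d_G(u,y)\neq d_G(v,y)$, and $\beta(G)$ is the minimum size of a resolving set; $S$ is doubly resolving if for all distinct $u,v$ there are $x,y\in S$ with $d_G(u,x)-d_G(u,y)\neq d_G(v,x)-d_G(v,y)$, and $\Psi(G)$ is the minimum size of a doubly resolving set. -}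

module Defs where

open import Data.Bool using (Bool; true; false; not; _∧_; _∨_; if_then_else_)
open import Data.Nat using (ℕ; zero; suc; _+_; _∸_; _≤_; _<_; _≡ᵇ_)
open import Data.Vec using (Vec; []; _∷_; map)
open import Data.List as List using (List; []; _∷_; length; concatMap)
open import Data.Bool.ListAction using (any)
open import Data.List.Relation.Unary.Unique.Propositional using (Unique)
open import Data.List.Membership.Propositional using (_∈_)
open import Data.Product using (Σ; _×_; _,_; ∃-syntax)
open import Data.Integer as ℤ using (ℤ; +_; _-_)
open import Data.Rational as ℚ using (ℚ)
open import Relation.Binary.PropositionalEquality using (_≡_; _≢_)

record FinGraph : Set₁ where
  field
    V     : Set
    verts : List V                 -- lists every vertex (exactly once)
    adj   : V → V → Bool

open FinGraph public

module _ (G : FinGraph) (eqB : V G → V G → Bool) where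

  ball : ℕ → V G → V G → Bool
  ball zero    u v = eqB u v
  ball (suc k) u v = ball k u v ∨ any (λ w → ball k u w ∧ adj G w v) (verts G)

  -- least k < |V| with a walk of length ≤ k; |V| if none exists
  -- (the usual graph distance, on connected graphs).
  distFrom : ℕ → ℕ → V G → V G → ℕ
  distFrom k zero      u v = k
  distFrom k (suc f) u v = if ball k u v then k else distFrom (suc k) f u v

  dist : V G → V G → ℕ
  dist u v = distFrom 0 (length (verts G)) u v

-- The vertex {u, ū} (u ∈ {0,1}^n, n ≥ 1) is represented by its unique
-- representative with first coordinate 0; a vertex is therefore a word
-- w ∈ {0,1}^(n-1) standing for the representative (0 ∷ w).

allWords : (m : ℕ) → List (Vec Bool m)
allWords zero    = [] ∷ []
allWords (suc m) = concatMap (λ w → (false ∷ w) ∷ (true ∷ w) ∷ []) (allWords m)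

hamming : {m : ℕ} → Vec Bool m → Vec Bool m → ℕ
hamming []       []       = 0
hamming (x ∷ xs) (y ∷ ys) = (if (x ∧ not y) ∨ (not x ∧ y) then 1 else 0) + hamming xs ys

complement : {m : ℕ} → Vec Bool m → Vec Bool m
complement = map not

eqVec : {m : ℕ} → Vec Bool m → Vec Bool m → Bool
eqVec xs ys = hamming xs ys ≡ᵇ 0

rep : (n : ℕ) → Vec Bool (n ∸ 1) → Vec Bool (suc (n ∸ 1))
rep n w = false ∷ w

foldedAdj : (n : ℕ) → Vec Bool (n ∸ 1) → Vec Bool (n ∸ 1) → Bool
foldedAdj n a b = (hamming (rep n a) (rep n b) ≡ᵇ 1)
                ∨ (hamming (rep n a) (complement (rep n b)) ≡ᵇ 1)

F : ℕ → FinGraph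
F n = record { V = Vec Bool (n ∸ 1) ; verts = allWords (n ∸ 1) ; adj = foldedAdj n }

dF : (n : ℕ) → Vec Bool (n ∸ 1) → Vec Bool (n ∸ 1) → ℕ
dF n = dist (F n) eqVec

Resolving : (n : ℕ) → List (Vec Bool (n ∸ 1)) → Set
Resolving n S = ∀ u v → u ≢ v → ∃[ y ] (y ∈ S × dF n u y ≢ dF n v y)

DoublyResolving : (n : ℕ) → List (Vec Bool (n ∸ 1)) → Set
DoublyResolving n S = ∀ u v → u ≢ v → ∃[ x ] ∃[ y ] (x ∈ S × y ∈ S ×
  ((+ dF n u x) - (+ dF n u y) ≢ (+ dF n v x) - (+ dF n v y)))

IsMinSize : {A : Set} → (List A → Set) → ℕ → Set
IsMinSize P b = (∃[ S ] (Unique S × P S × length S ≡ b))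
              × (∀ S → Unique S → P S → b ≤ length S)

IsMetricDim : ℕ → ℕ → Set
IsMetricDim n b = IsMinSize (Resolving n) b

IsDoubleMetricDim : ℕ → ℕ → Set
IsDoubleMetricDim n p = IsMinSize (DoublyResolving n) p

toℚ : ℕ → ℚ
toℚ n = (+ n) ℚ./ 1

EqPlusLittleO : (P : ℕ → Set) → (f g : ℕ → ℚ) → Set
EqPlusLittleO P f g = ∀ (ε : ℚ) → ℚ.0ℚ ℚ.< ε →
  ∃[ N ] (∀ n → N ≤ n → P n → ℚ.∣ f n ℚ.- g n ∣ ℚ.≤ ε ℚ.* toℚ n)

-- The distance in F_n between (normalised) words u, v of length m = n - 1 is
-- min(|u ⊕ v|, 1 + |u ⊕ v̄|), so the diameter is ⌊n/2⌋.  If S resolves F_n and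
-- A contains, for every vertex, a vertex at maximal distance from it, then
-- S ∪ A doubly resolves F_n.  Walking from 0 through 1, 11, 111, … to its
-- complement 1…1, the distance to any vertex changes by at most one per step
-- and its two end values add up to m, so it hits the diameter; for odd n every
-- second step suffices, giving |A| = (n + 1)/2, and for even n the walk is
-- started at a vertex of S, giving n - 1 new vertices.  For the asymptotics,
-- the distances to 0, to the rows of a detecting (coin-weighing) matrix and to
-- their complements determine a vertex, and recursively doubled detecting
-- matrices with 2^(t+1) rows have about t·2^t columns, so β(F_n) = O(n / log n).

module Submission where

open import Defs
open import Data.Bool as Bool using (Bool; true; false; T; _∧_; _xor_)
open import Data.Bool.Properties using (T-∧; T-∨; T-≡)
open import Data.Bool.ListAction using (any)
open import Data.Nat
open import Data.Nat.Properties
open import Data.Nat.DivMod using (m≡m%n+[m/n]*n; m*n/n≡m)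
open import Data.Vec as Vec using (Vec; []; _∷_; _++_)
open import Data.Vec.Properties using (≡-dec; take++drop≡id; ++-injectiveˡ; tabulate∘lookup; tabulate-cong)
open import Data.Fin as Fin using (Fin; zero; suc; _↑ˡ_; _↑ʳ_)
open import Data.Fin.Properties using (splitAt-↑ˡ; splitAt-↑ʳ)
open import Data.List as List using (List; []; _∷_; length; concatMap; deduplicate)
open import Data.List.Properties using (length-deduplicate; length-++; length-applyUpTo; length-map; length-tabulate)
open import Data.List.Relation.Binary.Subset.Propositional using (_⊆_)
open import Data.List.Relation.Unary.Unique.DecPropositional.Properties using (deduplicate-!)
open import Data.List.Relation.Unary.Any as Any using (here; there; any?)
open import Data.List.Relation.Unary.Any.Properties using (any⁺; any⁻)
open import Data.List.Membership.Propositional using (_∈_; find; lose)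
open import Data.List.Membership.Propositional.Properties
  using (∈-concatMap⁺; ∈-++⁺ˡ; ∈-++⁺ʳ; ∈-++⁻; ∈-deduplicate⁺; ∈-applyUpTo⁺; ∈-map⁺; ∈-tabulate⁺)
open import Data.Integer as ℤ using (ℤ; +_; -[1+_])
import Data.Integer.Properties as ℤP
open import Data.Rational as ℚ using (ℚ; mkℚ)
import Data.Rational.Properties as ℚP
open import Data.Rational.Unnormalised as ℚᵘ using (mkℚᵘ; *≡*; *≤*)
import Data.Rational.Unnormalised.Properties as ℚᵘP
open import Data.Nat.Coprimality using (Coprime)
import Data.Integer.Tactic.RingSolver as ℤ-Solver
import Data.Nat.Tactic.RingSolver as ℕ-Solver
open import Data.Product using (∃-syntax; _×_; _,_; proj₁; proj₂)
open import Data.Sum using (_⊎_; inj₁; inj₂; [_,_])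
open import Data.Empty using (⊥-elim)
open import Function using (Equivalence; _∘_)
open import Relation.Nullary using (yes; no; ¬?)
open import Relation.Nullary.Decidable using (decidable-stable)
open import Relation.Binary.Definitions using (DecidableEquality)
open import Relation.Binary.PropositionalEquality hiding ([_])

open Equivalence using (to; from)

zeros : ∀ m → Vec Bool m
zeros m = Vec.replicate m false

hamming-refl : ∀ {m} (x : Vec Bool m) → hamming x x ≡ 0
hamming-refl []          = refl
hamming-refl (true ∷ x)  = hamming-refl x
hamming-refl (false ∷ x) = hamming-refl x

hamming-sym : ∀ {m} (x y : Vec Bool m) → hamming x y ≡ hamming y x
hamming-sym []          []          = refl
hamming-sym (true ∷ x)  (true ∷ y)  = hamming-sym x y
hamming-sym (true ∷ x)  (false ∷ y) = cong suc (hamming-sym x y)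
hamming-sym (false ∷ x) (true ∷ y)  = cong suc (hamming-sym x y)
hamming-sym (false ∷ x) (false ∷ y) = hamming-sym x y

hamming-triangle : ∀ {m} (x y z : Vec Bool m) → hamming x z ≤ hamming x y + hamming y z
hamming-triangle []          []          []          = z≤n
hamming-triangle (true ∷ x)  (true ∷ y)  (true ∷ z)  = hamming-triangle x y z
hamming-triangle (true ∷ x)  (true ∷ y)  (false ∷ z) = ≤-trans (s≤s (hamming-triangle x y z)) (≤-reflexive (sym (+-suc _ _)))
hamming-triangle (true ∷ x)  (false ∷ y) (true ∷ z)  =
  ≤-trans (hamming-triangle x y z) (m≤n⇒m≤1+n (+-monoʳ-≤ (hamming x y) (n≤1+n _)))
hamming-triangle (true ∷ x)  (false ∷ y) (false ∷ z) = s≤s (hamming-triangle x y z)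
hamming-triangle (false ∷ x) (true ∷ y)  (true ∷ z)  = s≤s (hamming-triangle x y z)
hamming-triangle (false ∷ x) (true ∷ y)  (false ∷ z) =
  ≤-trans (hamming-triangle x y z) (m≤n⇒m≤1+n (+-monoʳ-≤ (hamming x y) (n≤1+n _)))
hamming-triangle (false ∷ x) (false ∷ y) (true ∷ z)  = ≤-trans (s≤s (hamming-triangle x y z)) (≤-reflexive (sym (+-suc _ _)))
hamming-triangle (false ∷ x) (false ∷ y) (false ∷ z) = hamming-triangle x y z

hamming≡0⇒≡ : ∀ {m} (x y : Vec Bool m) → hamming x y ≡ 0 → x ≡ y
hamming≡0⇒≡ []          []          _ = refl
hamming≡0⇒≡ (true ∷ x)  (true ∷ y)  e = cong (true ∷_) (hamming≡0⇒≡ x y e)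
hamming≡0⇒≡ (false ∷ x) (false ∷ y) e = cong (false ∷_) (hamming≡0⇒≡ x y e)

hamming+hamming-complement : ∀ {m} (x y : Vec Bool m) → hamming x y + hamming x (complement y) ≡ m
hamming+hamming-complement []          []          = refl
hamming+hamming-complement (true ∷ x)  (true ∷ y)  = trans (+-suc _ _) (cong suc (hamming+hamming-complement x y))
hamming+hamming-complement (true ∷ x)  (false ∷ y) = cong suc (hamming+hamming-complement x y)
hamming+hamming-complement (false ∷ x) (true ∷ y)  = cong suc (hamming+hamming-complement x y)
hamming+hamming-complement (false ∷ x) (false ∷ y) = trans (+-suc _ _) (cong suc (hamming+hamming-complement x y))

hamming≤ : ∀ {m} (x y : Vec Bool m) → hamming x y ≤ m
hamming≤ x y = ≤-trans (m≤m+n _ _) (≤-reflexive (hamming+hamming-complement x y))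

hamming-complement : ∀ {m} (x y : Vec Bool m) → hamming (complement x) (complement y) ≡ hamming x y
hamming-complement []          []          = refl
hamming-complement (true ∷ x)  (true ∷ y)  = hamming-complement x y
hamming-complement (true ∷ x)  (false ∷ y) = cong suc (hamming-complement x y)
hamming-complement (false ∷ x) (true ∷ y)  = cong suc (hamming-complement x y)
hamming-complement (false ∷ x) (false ∷ y) = hamming-complement x y

complement-involutive : ∀ {m} (x : Vec Bool m) → complement (complement x) ≡ x
complement-involutive []          = refl
complement-involutive (true ∷ x)  = cong (true ∷_) (complement-involutive x)
complement-involutive (false ∷ x) = cong (false ∷_) (complement-involutive x)

hamming-suc⇒neighbour : ∀ {m} (x y : Vec Bool m) k → hamming x y ≡ suc k →
                        ∃[ w ] (hamming x w ≡ k × hamming w y ≡ 1)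
hamming-suc⇒neighbour []          []          k ()
hamming-suc⇒neighbour (true ∷ x)  (false ∷ y) k e = true ∷ y , suc-injective e , cong suc (hamming-refl y)
hamming-suc⇒neighbour (false ∷ x) (true ∷ y)  k e = false ∷ y , suc-injective e , cong suc (hamming-refl y)
hamming-suc⇒neighbour (true ∷ x)  (true ∷ y)  k e with hamming-suc⇒neighbour x y k e
... | w , xw , wy = true ∷ w , xw , wy
hamming-suc⇒neighbour (false ∷ x) (false ∷ y) k e with hamming-suc⇒neighbour x y k e
... | w , xw , wy = false ∷ w , xw , wy

-- Distances in the folded cube

∈-allWords : ∀ {m} (w : Vec Bool m) → w ∈ allWords m
∈-allWords []          = here refl
∈-allWords (false ∷ w) = ∈-concatMap⁺ _ (Any.map (λ { refl → here refl }) (∈-allWords w))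
∈-allWords (true ∷ w)  = ∈-concatMap⁺ _ (Any.map (λ { refl → there (here refl) }) (∈-allWords w))

length-concatMap-pair : ∀ {A B : Set} (f g : A → B) (xs : List A) →
  length (concatMap (λ x → f x ∷ g x ∷ []) xs) ≡ length xs + length xs
length-concatMap-pair f g []       = refl
length-concatMap-pair f g (x ∷ xs) =
  cong suc (trans (cong suc (length-concatMap-pair f g xs)) (sym (+-suc (length xs) (length xs))))

m<length-allWords : ∀ m → m < length (allWords m)
m<length-allWords zero    = s≤s z≤n
m<length-allWords (suc m) =
  ≤-trans (+-mono-≤ (≤-trans (s≤s z≤n) ih) ih)
          (≤-reflexive (sym (length-concatMap-pair (false ∷_) (true ∷_) (allWords m))))
  where ih = m<length-allWords m

any-allWords : ∀ {m} (p : Vec Bool m → Bool) w → T (p w) → T (any p (allWords m))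
any-allWords p w pw = any⁺ p (Any.map (λ { refl → pw }) (∈-allWords w))

module _ (G : FinGraph) (eqB : V G → V G → Bool) (d : V G → V G → ℕ)
         (ball-sound    : ∀ k u v → T (ball G eqB k u v) → d u v ≤ k)
         (ball-complete : ∀ k u v → d u v ≤ k → T (ball G eqB k u v)) where

  distFrom≡ : ∀ f k u v → k ≤ d u v → d u v < k + f → distFrom G eqB k f u v ≡ d u v
  distFrom≡ zero    k u v k≤d d<k = ⊥-elim (<⇒≱ d<k (≤-trans (≤-reflexive (+-identityʳ k)) k≤d))
  distFrom≡ (suc f) k u v k≤d d<k with ball G eqB k u v in eq
  ... | true  = ≤-antisym k≤d (ball-sound k u v (from T-≡ eq))
  ... | false = distFrom≡ f (suc k) u v
                  (≰⇒> λ d≤k → subst T eq (ball-complete k u v d≤k))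
                  (≤-trans d<k (≤-reflexive (+-suc k f)))

  dist≡ : ∀ u v → d u v < length (verts G) → dist G eqB u v ≡ d u v
  dist≡ u v = distFrom≡ (length (verts G)) 0 u v z≤n

module _ {m : ℕ} where

  -- u is joined to v by a path of length h inside the cube and, through the
  -- antipodal edge to the complement of v, by one of length 1 + (m - h)
  foldedDist : Vec Bool m → Vec Bool m → ℕ
  foldedDist u v = hamming u v ⊓ suc (hamming u (complement v))

  adjacent⇒ : ∀ (w v : Vec Bool m) → T (foldedAdj (suc m) w v) → hamming w v ≡ 1 ⊎ w ≡ complement v
  adjacent⇒ w v a with to T-∨ a
  ... | inj₁ wv = inj₁ (≡ᵇ⇒≡ _ 1 wv)
  ... | inj₂ wv = inj₂ (hamming≡0⇒≡ w (complement v) (≡ᵇ⇒≡ _ 0 wv))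

  foldedDist-adjacent : ∀ u w v → T (foldedAdj (suc m) w v) → foldedDist u v ≤ suc (foldedDist u w)
  foldedDist-adjacent u w v a with adjacent⇒ w v a
  ... | inj₁ wv = ⊓-mono-≤ step (s≤s step̄)
    where
    step : hamming u v ≤ suc (hamming u w)
    step = ≤-trans (hamming-triangle u w v) (≤-reflexive (trans (cong (_+_ (hamming u w)) wv) (+-comm _ 1)))
    step̄ : hamming u (complement v) ≤ suc (hamming u (complement w))
    step̄ = ≤-trans (hamming-triangle u (complement w) (complement v))
                   (≤-reflexive (trans (cong (_+_ (hamming u (complement w))) (trans (hamming-complement w v) wv))
                                       (+-comm _ 1)))
  ... | inj₂ refl =
    ≤-trans (min-swap (hamming u v) (hamming u (complement v)))
            (s≤s (≤-reflexive (cong (λ z → hamming u (complement v) ⊓ suc (hamming u z))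
                                    (sym (complement-involutive v)))))
    where
    min-swap : ∀ x y → x ⊓ suc y ≤ suc (y ⊓ suc x)
    min-swap x y = ⊓-glb {_} {suc y} {suc (suc x)} (m⊓n≤n x (suc y))
                         (≤-trans (m⊓n≤m x (suc y)) (≤-trans (n≤1+n x) (n≤1+n (suc x))))

  ball-sound : ∀ k u v → T (ball (F (suc m)) eqVec k u v) → foldedDist u v ≤ k
  ball-sound zero    u v b = ≤-trans (m⊓n≤m _ _) (≤-reflexive (≡ᵇ⇒≡ _ 0 b))
  ball-sound (suc k) u v b with to T-∨ b
  ... | inj₁ uv = m≤n⇒m≤1+n (ball-sound k u v uv)
  ... | inj₂ uv with Any.satisfied (any⁻ (λ w → ball (F (suc m)) eqVec k u w ∧ foldedAdj (suc m) w v) (allWords m) uv)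
  ... | w , uwv with to T-∧ uwv
  ... | uw , wv = ≤-trans (foldedDist-adjacent u w v wv) (s≤s (ball-sound k u w uw))

  ball-complete : ∀ k u v → foldedDist u v ≤ k → T (ball (F (suc m)) eqVec k u v)
  ball-complete zero u v d≤0 with hamming u v
  ... | zero = _
  ... | suc _ with () ← d≤0
  ball-complete (suc k) u v d≤ with foldedDist u v ≤? k
  ... | yes d≤k = from T-∨ (inj₁ (ball-complete k u v d≤k))
  ... | no  d≰k with neighbour
    where
    d≡ : foldedDist u v ≡ suc k
    d≡ = ≤-antisym d≤ (≰⇒> d≰k)
    neighbour : ∃[ w ] (foldedDist u w ≤ k × T (foldedAdj (suc m) w v))
    neighbour with ⊓-sel (hamming u v) (suc (hamming u (complement v)))
    ... | inj₁ e with hamming-suc⇒neighbour u v k (trans (sym e) d≡)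
    ...   | w , uw , wv = w , ≤-trans (m⊓n≤m _ _) (≤-reflexive uw) , from T-∨ (inj₁ (≡⇒≡ᵇ _ 1 wv))
    neighbour | inj₂ e =
      complement v , ≤-trans (m⊓n≤m _ _) (≤-reflexive (suc-injective (trans (sym e) d≡))) ,
      from T-∨ (inj₂ (≡⇒≡ᵇ _ 0 (hamming-refl (complement v))))
  ... | w , uw , wv = from T-∨ (inj₂ (any-allWords _ w (from T-∧ (ball-complete k u w uw , wv))))

dF≡foldedDist : ∀ {m} (u v : Vec Bool m) → dF (suc m) u v ≡ foldedDist u v
dF≡foldedDist {m} u v = dist≡ (F (suc m)) eqVec foldedDist ball-sound ball-complete u v
  (≤-trans (s≤s (≤-trans (m⊓n≤m _ _) (hamming≤ u v))) (m<length-allWords m))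

m-n≡o-p⇒m+p≡o+n : ∀ m n o p → + m ℤ.- + n ≡ + o ℤ.- + p → m + p ≡ o + n
m-n≡o-p⇒m+p≡o+n m n o p eq = ℤP.+-injective (begin
  + (m + p)                        ≡⟨ ℤP.pos-+ m p ⟩
  + m ℤ.+ + p                      ≡⟨ regroup (+ m) (+ n) (+ p) ⟩
  (+ m ℤ.- + n) ℤ.+ (+ n ℤ.+ + p)  ≡⟨ cong (ℤ._+ (+ n ℤ.+ + p)) eq ⟩
  (+ o ℤ.- + p) ℤ.+ (+ n ℤ.+ + p)  ≡⟨ cancel (+ o) (+ n) (+ p) ⟩
  + o ℤ.+ + n                      ≡⟨ ℤP.pos-+ o n ⟨
  + (o + n)                        ∎)
  where
  open ≡-Reasoning
  regroup : ∀ x y z → x ℤ.+ z ≡ (x ℤ.- y) ℤ.+ (y ℤ.+ z)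
  regroup = ℤ-Solver.solve-∀
  cancel : ∀ x y z → (x ℤ.- z) ℤ.+ (y ℤ.+ z) ≡ x ℤ.+ y
  cancel = ℤ-Solver.solve-∀

IsMinSize-≤-length : ∀ {A : Set} {P : List A → Set} {b} → DecidableEquality A →
  (∀ {S S′} → S ⊆ S′ → P S → P S′) → IsMinSize P b → ∀ {S} → P S → b ≤ length S
IsMinSize-≤-length _≟_ mono (_ , minimal) {S} pS =
  ≤-trans (minimal _ (deduplicate-! _≟_ S) (mono (∈-deduplicate⁺ _≟_) pS)) (length-deduplicate _≟_ S)

module _ (n : ℕ) where

  private
    Vertex : Set
    Vertex = Vec Bool (n ∸ 1)

    Δ : Vertex → Vertex → Vertex → ℤ
    Δ w x y = + dF n w x ℤ.- + dF n w y

    Δ-cross : ∀ {u v x y} → Δ u x y ≡ Δ v x y → dF n u x + dF n v y ≡ dF n v x + dF n u y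
    Δ-cross {u} {v} {x} {y} = m-n≡o-p⇒m+p≡o+n (dF n u x) (dF n u y) (dF n v x) (dF n v y)

  resolving-mono : ∀ {S S′ : List Vertex} → S ⊆ S′ → Resolving n S → Resolving n S′
  resolving-mono S⊆S′ res u v u≢v with res u v u≢v
  ... | y , y∈S , sep = y , S⊆S′ y∈S , sep

  doublyResolving-mono : ∀ {S S′ : List Vertex} → S ⊆ S′ → DoublyResolving n S → DoublyResolving n S′
  doublyResolving-mono S⊆S′ res u v u≢v with res u v u≢v
  ... | x , y , x∈S , y∈S , sep = x , y , S⊆S′ x∈S , S⊆S′ y∈S , sep

  -- A vertex at maximal distance D from u (an "antipode") together with a
  -- vertex y resolving u and v separates them doubly, unless d(v,y) ≤ d(u,y);
  -- the symmetric argument with an antipode of v then gives d(u,y) = d(v,y).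
  resolving+antipodal⇒doublyResolving : ∀ (S A : List Vertex) D →
    Resolving n S → (∀ u t → dF n u t ≤ D) → (∀ u → ∃[ t ] (t ∈ A × dF n u t ≡ D)) →
    DoublyResolving n (S List.++ A)
  resolving+antipodal⇒doublyResolving S A D res diam antipode u v u≢v
    with res u v u≢v | antipode u | antipode v
  ... | y , y∈S , sep | tᵤ , tᵤ∈A , uD | tᵥ , tᵥ∈A , vD
    with Δ u y tᵤ ℤ.≟ Δ v y tᵤ | Δ u y tᵥ ℤ.≟ Δ v y tᵥ
  ... | no sepᵤ | _       = y , tᵤ , ∈-++⁺ˡ y∈S , ∈-++⁺ʳ S tᵤ∈A , sepᵤ
  ... | yes _   | no sepᵥ = y , tᵥ , ∈-++⁺ˡ y∈S , ∈-++⁺ʳ S tᵥ∈A , sepᵥ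
  ... | yes eᵤ  | yes eᵥ  = ⊥-elim (sep (≤-antisym u≤v v≤u))
    where
    v≤u : dF n v y ≤ dF n u y
    v≤u = +-cancelʳ-≤ D _ _ (begin
      dF n v y + D             ≡⟨ cong (_+_ (dF n v y)) (sym uD) ⟩
      dF n v y + dF n u tᵤ     ≡⟨ sym (Δ-cross eᵤ) ⟩
      dF n u y + dF n v tᵤ     ≤⟨ +-monoʳ-≤ (dF n u y) (diam v tᵤ) ⟩
      dF n u y + D             ∎)
      where open ≤-Reasoning
    u≤v : dF n u y ≤ dF n v y
    u≤v = +-cancelʳ-≤ D _ _ (begin
      dF n u y + D             ≡⟨ cong (_+_ (dF n u y)) (sym vD) ⟩
      dF n u y + dF n v tᵥ     ≡⟨ Δ-cross eᵥ ⟩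
      dF n v y + dF n u tᵥ     ≤⟨ +-monoʳ-≤ (dF n v y) (diam u tᵥ) ⟩
      dF n v y + D             ∎)
      where open ≤-Reasoning

Ψ≤length : ∀ n {p} {L : List (Vec Bool (n ∸ 1))} → IsDoubleMetricDim n p → DoublyResolving n L → p ≤ length L
Ψ≤length n ψ = IsMinSize-≤-length (≡-dec Bool._≟_) (doublyResolving-mono n) ψ

resolving-nonempty : ∀ {m} {S : List (Vec Bool (suc m))} → Resolving (suc (suc m)) S → ∃[ s ] (s ∈ S)
resolving-nonempty {m} res with res (zeros (suc m)) (true ∷ zeros m) (λ ())
... | s , s∈S , _ = s , s∈S

1≤β : ∀ {m b} → IsMetricDim (suc (suc m)) b → 1 ≤ b
1≤β ((S , _ , res , refl) , _) with resolving-nonempty res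
... | _ , here _  = s≤s z≤n
... | _ , there _ = s≤s z≤n

-- Antipodal sets of the folded cube

⊓-suc≤ : ∀ h h̄ r → h + h̄ ≤ r + r → h ⊓ suc h̄ ≤ r
⊓-suc≤ h h̄ r h+h̄≤ with h ≤? r
... | yes h≤r = ≤-trans (m⊓n≤m h _) h≤r
... | no  h≰r = ≤-trans (m⊓n≤n h _) (+-cancelˡ-≤ r _ _ (begin
  r + suc h̄  ≡⟨ +-suc r h̄ ⟩
  suc r + h̄  ≤⟨ +-monoˡ-≤ h̄ (≰⇒> h≰r) ⟩
  h + h̄      ≤⟨ h+h̄≤ ⟩
  r + r      ∎))
  where open ≤-Reasoning

module _ {m : ℕ} (r : ℕ) (m≤2r : m ≤ r + r) (u v : Vec Bool m) where

  foldedDist≤ : foldedDist u v ≤ r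
  foldedDist≤ = ⊓-suc≤ _ _ r (≤-trans (≤-reflexive (hamming+hamming-complement u v)) m≤2r)

  foldedDist≡ : r ≤ hamming u v → hamming u v + r ≤ suc m → foldedDist u v ≡ r
  foldedDist≡ r≤h h+r≤ = ≤-antisym foldedDist≤ (⊓-glb r≤h (+-cancelˡ-≤ (hamming u v) _ _ (begin
    hamming u v + r                               ≤⟨ h+r≤ ⟩
    suc m                                         ≡⟨ cong suc (hamming+hamming-complement u v) ⟨
    suc (hamming u v + hamming u (complement v))  ≡⟨ +-suc _ _ ⟨
    hamming u v + suc (hamming u (complement v))  ∎)))
    where open ≤-Reasoning

window-crossing : ∀ (g : ℕ → ℕ) w a K →
  (∀ i → g (suc i) ≤ suc w + g i) → (∀ i → g i ≤ suc w + g (suc i)) →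
  (g 0 ≤ a + w × a ≤ g K) ⊎ (a ≤ g 0 × g K ≤ a + w) →
  ∃[ i ] (i ≤ K × a ≤ g i × g i ≤ a + w)
window-crossing g w a zero    _  _    (inj₁ (g0≤ , a≤g0)) = 0 , z≤n , a≤g0 , g0≤
window-crossing g w a zero    _  _    (inj₂ (a≤g0 , g0≤)) = 0 , z≤n , a≤g0 , g0≤
window-crossing g w a (suc K) up down (inj₁ (g0≤ , a≤gK)) with a ≤? g 0
... | yes a≤g0 = 0 , z≤n , a≤g0 , g0≤
... | no  a≰g0 = shift (window-crossing (g ∘ suc) w a K (up ∘ suc) (down ∘ suc) (inj₁ (g1≤ , a≤gK)))
  where
  g1≤ : g 1 ≤ a + w
  g1≤ = begin
    g 1            ≤⟨ up 0 ⟩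
    suc w + g 0    ≡⟨ +-suc w (g 0) ⟨
    w + suc (g 0)  ≤⟨ +-monoʳ-≤ w (≰⇒> a≰g0) ⟩
    w + a          ≡⟨ +-comm w a ⟩
    a + w          ∎
    where open ≤-Reasoning
  shift : ∃[ i ] (i ≤ K × a ≤ g (suc i) × g (suc i) ≤ a + w) → ∃[ i ] (i ≤ suc K × a ≤ g i × g i ≤ a + w)
  shift (i , i≤K , lo , hi) = suc i , s≤s i≤K , lo , hi
window-crossing g w a (suc K) up down (inj₂ (a≤g0 , gK≤)) with g 0 ≤? a + w
... | yes g0≤ = 0 , z≤n , a≤g0 , g0≤
... | no  g0≰ = shift (window-crossing (g ∘ suc) w a K (up ∘ suc) (down ∘ suc) (inj₂ (a≤g1 , gK≤)))
  where
  a≤g1 : a ≤ g 1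
  a≤g1 = +-cancelʳ-≤ w _ _ (≤-pred (begin
    suc (a + w)    ≤⟨ ≰⇒> g0≰ ⟩
    g 0            ≤⟨ down 0 ⟩
    suc w + g 1    ≡⟨ cong suc (+-comm w (g 1)) ⟩
    suc (g 1 + w)  ∎))
    where open ≤-Reasoning
  shift : ∃[ i ] (i ≤ K × a ≤ g (suc i) × g (suc i) ≤ a + w) → ∃[ i ] (i ≤ suc K × a ≤ g i × g i ≤ a + w)
  shift (i , i≤K , lo , hi) = suc i , s≤s i≤K , lo , hi

opposite-sides : ∀ {g₀ g₁ m} r w → g₀ + g₁ ≡ m → r + (r + w) ≡ suc m →
  (g₀ ≤ r + w × r ≤ g₁) ⊎ (r ≤ g₀ × g₁ ≤ r + w)
opposite-sides {g₀} {g₁} {m} r w g₀+g₁≡m 2r+w≡ with r ≤? g₀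
... | yes r≤g₀ = inj₂ (r≤g₀ , +-cancelˡ-≤ r _ _ (begin
  r + g₁       ≤⟨ +-monoˡ-≤ g₁ r≤g₀ ⟩
  g₀ + g₁      ≡⟨ g₀+g₁≡m ⟩
  m            ≤⟨ n≤1+n m ⟩
  suc m        ≡⟨ 2r+w≡ ⟨
  r + (r + w)  ∎))
  where open ≤-Reasoning
... | no r≰g₀ = inj₁ (≤-trans (<⇒≤ (≰⇒> r≰g₀)) (m≤m+n r w) , +-cancelˡ-≤ g₀ _ _ (≤-pred (begin
  suc (g₀ + r)  ≤⟨ +-monoˡ-≤ r (≰⇒> r≰g₀) ⟩
  r + r         ≤⟨ +-monoʳ-≤ r (m≤m+n r w) ⟩
  r + (r + w)   ≡⟨ 2r+w≡ ⟩
  suc m         ≡⟨ cong suc g₀+g₁≡m ⟨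
  suc (g₀ + g₁) ∎)))
  where open ≤-Reasoning

-- |u ⊕ p i| moves by at most w + 1 per step and its end values add up to m,
-- so it crosses the window [r, r + w], where the folded distance is r
antipodal-walk : ∀ {m} r w K (p : ℕ → Vec Bool m) → m ≤ r + r → r + (r + w) ≡ suc m →
  (∀ i → hamming (p i) (p (suc i)) ≤ suc w) → p K ≡ complement (p 0) →
  ∀ u → ∃[ i ] (i ≤ K × foldedDist u (p i) ≡ r)
antipodal-walk {m} r w K p m≤2r 2r+w≡ step end u with window-crossing g w r K up down (opposite-sides r w g0+gK 2r+w≡)
  where
  g : ℕ → ℕ
  g i = hamming u (p i)
  up : ∀ i → g (suc i) ≤ suc w + g i
  up i = ≤-trans (hamming-triangle u (p i) (p (suc i)))
                 (≤-trans (+-monoʳ-≤ (g i) (step i)) (≤-reflexive (+-comm (g i) (suc w))))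
  down : ∀ i → g i ≤ suc w + g (suc i)
  down i = ≤-trans (hamming-triangle u (p (suc i)) (p i))
                   (≤-trans (+-monoʳ-≤ (g (suc i)) (≤-trans (≤-reflexive (hamming-sym (p (suc i)) (p i))) (step i)))
                            (≤-reflexive (+-comm (g (suc i)) (suc w))))
  g0+gK : g 0 + g K ≡ m
  g0+gK = trans (cong (_+_ (g 0)) (cong (hamming u) end)) (hamming+hamming-complement u (p 0))
... | i , i≤K , r≤gi , gi≤ = i , i≤K , foldedDist≡ r m≤2r u (p i) r≤gi (begin
  hamming u (p i) + r  ≤⟨ +-monoˡ-≤ r gi≤ ⟩
  r + w + r            ≡⟨ +-comm (r + w) r ⟩
  r + (r + w)          ≡⟨ 2r+w≡ ⟩
  suc m                ∎)
  where open ≤-Reasoning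

prefix : ∀ m → ℕ → Vec Bool m
prefix m       zero    = zeros m
prefix zero    (suc j) = []
prefix (suc m) (suc j) = true ∷ prefix m j

hamming-prefix-suc : ∀ m j → hamming (prefix m j) (prefix m (suc j)) ≤ 1
hamming-prefix-suc zero    zero    = z≤n
hamming-prefix-suc zero    (suc j) = z≤n
hamming-prefix-suc (suc m) zero    = s≤s (≤-reflexive (hamming-refl (zeros m)))
hamming-prefix-suc (suc m) (suc j) = hamming-prefix-suc m j

prefix-full : ∀ m → prefix m m ≡ complement (zeros m)
prefix-full zero    = refl
prefix-full (suc m) = cong (true ∷_) (prefix-full m)

infixl 6 _⊕_
_⊕_ : ∀ {m} → Vec Bool m → Vec Bool m → Vec Bool m
_⊕_ = Vec.zipWith _xor_

hamming-⊕ : ∀ {m} (s x y : Vec Bool m) → hamming (s ⊕ x) (s ⊕ y) ≡ hamming x y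
hamming-⊕ []          []          []          = refl
hamming-⊕ (false ∷ s) (a ∷ x)     (b ∷ y)     = cong (_+_ _) (hamming-⊕ s x y)
hamming-⊕ (true ∷ s)  (true ∷ x)  (true ∷ y)  = hamming-⊕ s x y
hamming-⊕ (true ∷ s)  (true ∷ x)  (false ∷ y) = cong suc (hamming-⊕ s x y)
hamming-⊕ (true ∷ s)  (false ∷ x) (true ∷ y)  = cong suc (hamming-⊕ s x y)
hamming-⊕ (true ∷ s)  (false ∷ x) (false ∷ y) = hamming-⊕ s x y

⊕-complement : ∀ {m} (s x : Vec Bool m) → s ⊕ complement x ≡ complement (s ⊕ x)
⊕-complement []          []          = refl
⊕-complement (true ∷ s)  (true ∷ x)  = cong (true ∷_) (⊕-complement s x)
⊕-complement (true ∷ s)  (false ∷ x) = cong (false ∷_) (⊕-complement s x)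
⊕-complement (false ∷ s) (true ∷ x)  = cong (false ∷_) (⊕-complement s x)
⊕-complement (false ∷ s) (false ∷ x) = cong (true ∷_) (⊕-complement s x)

⊕-zeros : ∀ {m} (s : Vec Bool m) → s ⊕ zeros m ≡ s
⊕-zeros []          = refl
⊕-zeros (true ∷ s)  = cong (true ∷_) (⊕-zeros s)
⊕-zeros (false ∷ s) = cong (false ∷_) (⊕-zeros s)

dF≤ : ∀ {m} r → m ≤ r + r → ∀ (u v : Vec Bool m) → dF (suc m) u v ≤ r
dF≤ r m≤2r u v = subst (_≤ r) (sym (dF≡foldedDist u v)) (foldedDist≤ r m≤2r u v)

Ψ[1+2r]≤β+1+r : ∀ r {b p} → IsMetricDim (suc (r + r)) b → IsDoubleMetricDim (suc (r + r)) p → p ≤ b + suc r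
Ψ[1+2r]≤β+1+r r {b} {p} ((S , _ , resS , |S|≡b) , _) ψ = begin
  p                   ≤⟨ Ψ≤length (suc m) ψ
                           (resolving+antipodal⇒doublyResolving (suc m) S antipodes r resS (dF≤ r ≤-refl) antipode) ⟩
  length (S List.++ antipodes) ≡⟨ length-++ S ⟩
  length S + length antipodes ≡⟨ cong₂ _+_ |S|≡b (length-applyUpTo walk (suc r)) ⟩
  b + suc r           ∎
  where
  open ≤-Reasoning
  m = r + r
  walk : ℕ → Vec Bool m
  walk i = prefix m (i + i)
  antipodes = List.applyUpTo walk (suc r)
  step : ∀ i → hamming (walk i) (walk (suc i)) ≤ 2
  step i rewrite +-suc i i =
    ≤-trans (hamming-triangle (prefix m (i + i)) (prefix m (suc (i + i))) (prefix m (suc (suc (i + i)))))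
            (+-mono-≤ (hamming-prefix-suc m (i + i)) (hamming-prefix-suc m (suc (i + i))))
  antipode : ∀ u → ∃[ t ] (t ∈ antipodes × dF (suc m) u t ≡ r)
  antipode u with antipodal-walk r 1 r walk ≤-refl (trans (cong (_+_ r) (+-comm r 1)) (+-suc r r)) step (prefix-full m) u
  ... | i , i≤r , d≡r = walk i , ∈-applyUpTo⁺ walk (s≤s i≤r) , trans (dF≡foldedDist u (walk i)) d≡r

-- the walk starts at a vertex s of the resolving set, which saves one vertex
Ψ[2+k]≤β+1+k : ∀ k r {b p} → suc (suc k) ≡ r + r →
  IsMetricDim (suc (suc k)) b → IsDoubleMetricDim (suc (suc k)) p → p ≤ b + suc k
Ψ[2+k]≤β+1+k k r {b} {p} n≡2r ((S , _ , resS , |S|≡b) , _) ψ with resolving-nonempty resS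
... | s , s∈S = begin
  p                            ≤⟨ Ψ≤length n ψ (doublyResolving-mono n S++A⊆S++A′
                                    (resolving+antipodal⇒doublyResolving n S antipodes r resS (dF≤ r m≤2r) antipode)) ⟩
  length (S List.++ antipodes′) ≡⟨ length-++ S ⟩
  length S + length antipodes′  ≡⟨ cong₂ _+_ |S|≡b (length-applyUpTo (walk ∘ suc) m) ⟩
  b + m                         ∎
  where
  open ≤-Reasoning
  m = suc k
  n = suc m
  m≤2r : m ≤ r + r
  m≤2r = ≤-trans (n≤1+n m) (≤-reflexive n≡2r)
  walk : ℕ → Vec Bool m
  walk j = s ⊕ prefix m j
  antipodes antipodes′ : List (Vec Bool m)
  antipodes  = List.applyUpTo walk (suc m)
  antipodes′ = List.applyUpTo (walk ∘ suc) m
  S++A⊆S++A′ : S List.++ antipodes ⊆ S List.++ antipodes′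
  S++A⊆S++A′ x∈ with ∈-++⁻ S x∈
  ... | inj₁ x∈S          = ∈-++⁺ˡ x∈S
  ... | inj₂ (here refl)  = ∈-++⁺ˡ (subst (_∈ S) (sym (⊕-zeros s)) s∈S)
  ... | inj₂ (there x∈A′) = ∈-++⁺ʳ S x∈A′
  step : ∀ j → hamming (walk j) (walk (suc j)) ≤ 1
  step j = ≤-trans (≤-reflexive (hamming-⊕ s (prefix m j) _)) (hamming-prefix-suc m j)
  end : walk m ≡ complement (walk 0)
  end = trans (cong (_⊕_ s) (prefix-full m)) (⊕-complement s (zeros m))
  antipode : ∀ u → ∃[ t ] (t ∈ antipodes × dF n u t ≡ r)
  antipode u with antipodal-walk r 0 m walk m≤2r (trans (cong (_+_ r) (+-identityʳ r)) (sym n≡2r)) step end u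
  ... | j , j≤m , d≡r = walk j , ∈-applyUpTo⁺ walk (s≤s j≤m) , trans (dF≡foldedDist u (walk j)) d≡r

-- Detecting matrices

dot : ∀ {k} → Vec Bool k → Vec Bool k → ℕ
dot []          []          = 0
dot (true ∷ x)  (true ∷ y)  = suc (dot x y)
dot (true ∷ x)  (false ∷ y) = dot x y
dot (false ∷ x) (_ ∷ y)     = dot x y

ones : ∀ k → Vec Bool k
ones k = Vec.replicate k true

weight : ∀ {k} → Vec Bool k → ℕ
weight {k} x = dot x (ones k)

bit : Bool → ℕ
bit true  = 1
bit false = 0

dot-++ : ∀ {k l} (x : Vec Bool k) (x′ : Vec Bool l) y y′ → dot (x ++ x′) (y ++ y′) ≡ dot x y + dot x′ y′
dot-++ []          x′ []          y′ = refl
dot-++ (true ∷ x)  x′ (true ∷ y)  y′ = cong suc (dot-++ x x′ y y′)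
dot-++ (true ∷ x)  x′ (false ∷ y) y′ = dot-++ x x′ y y′
dot-++ (false ∷ x) x′ (_ ∷ y)     y′ = dot-++ x x′ y y′

dot-zerosʳ : ∀ {k} (x : Vec Bool k) → dot x (zeros k) ≡ 0
dot-zerosʳ []          = refl
dot-zerosʳ (true ∷ x)  = dot-zerosʳ x
dot-zerosʳ (false ∷ x) = dot-zerosʳ x

dot-zerosˡ : ∀ {k} (y : Vec Bool k) → dot (zeros k) y ≡ 0
dot-zerosˡ []      = refl
dot-zerosˡ (_ ∷ y) = dot-zerosˡ y

dot-complement : ∀ {k} (x y : Vec Bool k) → dot x (complement y) + dot x y ≡ weight x
dot-complement []          []          = refl
dot-complement (true ∷ x)  (true ∷ y)  = trans (+-suc _ _) (cong suc (dot-complement x y))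
dot-complement (true ∷ x)  (false ∷ y) = cong suc (dot-complement x y)
dot-complement (false ∷ x) (true ∷ y)  = dot-complement x y
dot-complement (false ∷ x) (false ∷ y) = dot-complement x y

hamming+2*dot : ∀ {k} (x y : Vec Bool k) → hamming x y + 2 * dot x y ≡ weight x + weight y
hamming+2*dot []          []          = refl
hamming+2*dot (true ∷ x)  (true ∷ y)  = begin
  hamming x y + 2 * suc (dot x y)  ≡⟨ cong (_+_ (hamming x y)) (*-suc 2 (dot x y)) ⟩
  hamming x y + (2 + 2 * dot x y)  ≡⟨ +-suc _ _ ⟩
  suc (hamming x y + suc (2 * dot x y)) ≡⟨ cong suc (+-suc _ _) ⟩
  suc (suc (hamming x y + 2 * dot x y)) ≡⟨ cong (λ z → suc (suc z)) (hamming+2*dot x y) ⟩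
  suc (suc (weight x + weight y))  ≡⟨ cong suc (+-suc (weight x) (weight y)) ⟨
  suc (weight x + suc (weight y))  ∎
  where open ≡-Reasoning
hamming+2*dot (true ∷ x)  (false ∷ y) = cong suc (hamming+2*dot x y)
hamming+2*dot (false ∷ x) (true ∷ y)  = trans (cong suc (hamming+2*dot x y)) (sym (+-suc (weight x) (weight y)))
hamming+2*dot (false ∷ x) (false ∷ y) = hamming+2*dot x y

hamming-zeros : ∀ {k} (x : Vec Bool k) → hamming x (zeros k) ≡ weight x
hamming-zeros []          = refl
hamming-zeros (true ∷ x)  = cong suc (hamming-zeros x)
hamming-zeros (false ∷ x) = hamming-zeros x

unit : ∀ {q} → Fin q → Vec Bool q
unit {suc q} zero    = true ∷ zeros q
unit         (suc i) = false ∷ unit i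

dot-unit : ∀ {q} (c : Vec Bool q) (i : Fin q) → dot c (unit i) ≡ bit (Vec.lookup c i)
dot-unit (true ∷ c)  zero    = cong suc (dot-zerosʳ c)
dot-unit (false ∷ c) zero    = dot-zerosʳ c
dot-unit (true ∷ c)  (suc i) = dot-unit c i
dot-unit (false ∷ c) (suc i) = dot-unit c i

-- q weighings that determine every subset of k coins
record Detecting (k q : ℕ) : Set where
  field
    row     : Fin q → Vec Bool k
    detects : ∀ x y → (∀ i → dot x (row i) ≡ dot y (row i)) → x ≡ y

open Detecting

detecting-1 : Detecting 1 1
detecting-1 = record { row = λ _ → true ∷ [] ; detects = detects-1 }
  where
  detects-1 : ∀ x y → (∀ i → dot x (true ∷ []) ≡ dot y (true ∷ [])) → x ≡ y
  detects-1 (true ∷ [])  (true ∷ [])  _ = refl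
  detects-1 (false ∷ []) (false ∷ []) _ = refl
  detects-1 (true ∷ [])  (false ∷ []) h with () ← h zero
  detects-1 (false ∷ []) (true ∷ [])  h with () ← h zero

detecting-restrict : ∀ {k r q} → Detecting (k + r) q → Detecting k q
detecting-restrict {k} {r} {q} D = record { row = λ i → Vec.take k (row D i) ; detects = detects′ }
  where
  detects′ : ∀ x y → (∀ i → dot x (Vec.take k (row D i)) ≡ dot y (Vec.take k (row D i))) → x ≡ y
  detects′ x y H = ++-injectiveˡ x y (detects D (x ++ zeros r) (y ++ zeros r) H′)
    where
    padded : ∀ x i → dot (x ++ zeros r) (row D i) ≡ dot x (Vec.take k (row D i))
    padded x i = begin
      dot (x ++ zeros r) (row D i)                                     ≡⟨ cong (dot (x ++ zeros r)) (take++drop≡id k (row D i)) ⟨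
      dot (x ++ zeros r) (Vec.take k (row D i) ++ Vec.drop k (row D i)) ≡⟨ dot-++ x (zeros r) _ _ ⟩
      dot x (Vec.take k (row D i)) + dot (zeros r) (Vec.drop k (row D i)) ≡⟨ cong (_+_ _) (dot-zerosˡ (Vec.drop k (row D i))) ⟩
      dot x (Vec.take k (row D i)) + 0                                     ≡⟨ +-identityʳ _ ⟩
      dot x (Vec.take k (row D i))                                         ∎
      where open ≡-Reasoning
    H′ : ∀ i → dot (x ++ zeros r) (row D i) ≡ dot (y ++ zeros r) (row D i)
    H′ i = trans (padded x i) (trans (H i) (sym (padded y i)))

-- From A + B and A + (W - B) + u, where u is a bit and W is known, one reads
-- off 2B - u, hence u by parity and then B.
recover-summand-and-bit : ∀ A B B̄ A′ B′ B̄′ W u u′ →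
  A + B ≡ A′ + B′ → A + (B̄ + bit u) ≡ A′ + (B̄′ + bit u′) → B̄ + B ≡ W → B̄′ + B′ ≡ W →
  B ≡ B′ × u ≡ u′
recover-summand-and-bit A B B̄ A′ B′ B̄′ W u u′ e₁ e₂ w w′ = by-parity u u′ key
  where
  X = (A + B) + (B̄ + B)
  regroup : ∀ A B B̄ c B′ → c + 2 * B′ + ((A + B) + (B̄ + B)) ≡ (A + (B̄ + c)) + 2 * B + 2 * B′
  regroup = ℕ-Solver.solve-∀
  regroup′ : ∀ A B B̄ c B′ → (A + (B̄ + c)) + 2 * B′ + 2 * B ≡ c + 2 * B′ + ((A + B) + (B̄ + B))
  regroup′ = ℕ-Solver.solve-∀
  key : bit u + 2 * B′ ≡ bit u′ + 2 * B
  key = +-cancelʳ-≡ X _ _ (begin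
    bit u + 2 * B′ + X                         ≡⟨ regroup A B B̄ (bit u) B′ ⟩
    (A + (B̄ + bit u)) + 2 * B + 2 * B′         ≡⟨ cong (λ z → z + 2 * B + 2 * B′) e₂ ⟩
    (A′ + (B̄′ + bit u′)) + 2 * B + 2 * B′      ≡⟨ regroup′ A′ B′ B̄′ (bit u′) B ⟩
    bit u′ + 2 * B + ((A′ + B′) + (B̄′ + B′))   ≡⟨ cong (_+_ (bit u′ + 2 * B)) (cong₂ _+_ e₁ (trans w (sym w′))) ⟨
    bit u′ + 2 * B + X                         ∎)
    where open ≡-Reasoning
  by-parity : ∀ u u′ → bit u + 2 * B′ ≡ bit u′ + 2 * B → B ≡ B′ × u ≡ u′
  by-parity true  true  k = *-cancelˡ-≡ B B′ 2 (sym (suc-injective k)) , refl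
  by-parity false false k = *-cancelˡ-≡ B B′ 2 (sym k) , refl
  by-parity true  false k = ⊥-elim (even≢odd B B′ (sym k))
  by-parity false true  k = ⊥-elim (even≢odd B′ B k)

dot-++₃ : ∀ {k l o} (a : Vec Bool k) (b : Vec Bool l) (c : Vec Bool o) r s t →
          dot (a ++ b ++ c) (r ++ s ++ t) ≡ dot a r + (dot b s + dot c t)
dot-++₃ a b c r s t = trans (dot-++ a (b ++ c) r (s ++ t)) (cong (_+_ (dot a r)) (dot-++ b c s t))

doubling-recovers : ∀ {k q} (D : Detecting k q) {a a′ b b′ : Vec Bool k} {c c′ : Vec Bool q} →
  (∀ j → dot a (row D j) + dot b (row D j) ≡ dot a′ (row D j) + dot b′ (row D j)) →
  (∀ j → dot a (row D j) + (dot b (complement (row D j)) + bit (Vec.lookup c j))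
       ≡ dot a′ (row D j) + (dot b′ (complement (row D j)) + bit (Vec.lookup c′ j))) →
  weight b ≡ weight b′ → a ≡ a′ × b ≡ b′ × c ≡ c′
doubling-recovers D {a} {a′} {b} {b′} {c} {c′} sums diffs weights = a≡a′ , b≡b′ , c≡c′
  where
  R = row D
  recovered : ∀ j → dot b (R j) ≡ dot b′ (R j) × Vec.lookup c j ≡ Vec.lookup c′ j
  recovered j = recover-summand-and-bit _ _ _ _ _ _ (weight b) _ _ (sums j) (diffs j)
                  (dot-complement b (R j)) (trans (dot-complement b′ (R j)) (sym weights))
  b≡b′ : b ≡ b′
  b≡b′ = detects D b b′ (proj₁ ∘ recovered)
  c≡c′ : c ≡ c′
  c≡c′ = trans (sym (tabulate∘lookup c)) (trans (tabulate-cong (proj₂ ∘ recovered)) (tabulate∘lookup c′))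
  a≡a′ : a ≡ a′
  a≡a′ = detects D a a′ λ j →
    +-cancelʳ-≡ (dot b (R j)) _ _ (trans (sums j) (cong (_+_ (dot a′ (R j))) (sym (proj₁ (recovered j)))))

-- Weighing x = (a, b, c) against (R, R, 0), (R, R̄, e_j) and (0, 1, 0)
-- reveals a·R + b·R, a·R + b·R̄ + c_j and |b|.
detecting-double : ∀ {k q} → Detecting k q → Detecting (k + (k + q)) (q + (q + 1))
detecting-double {k} {q} D = record { row = row′ ; detects = detects′ }
  where
  R = row D
  sumRow diffRow : Fin q → Vec Bool (k + (k + q))
  sumRow  j = R j ++ R j ++ zeros q
  diffRow j = R j ++ complement (R j) ++ unit j
  weightRow : Vec Bool (k + (k + q))
  weightRow = zeros k ++ ones k ++ zeros q
  row′ : Fin (q + (q + 1)) → Vec Bool (k + (k + q))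
  row′ i = [ sumRow , [ diffRow , (λ _ → weightRow) ] ∘ Fin.splitAt q ] (Fin.splitAt q i)
  row-sum : ∀ j → row′ (j ↑ˡ (q + 1)) ≡ sumRow j
  row-sum j rewrite splitAt-↑ˡ q j (q + 1) = refl
  row-diff : ∀ j → row′ (q ↑ʳ (j ↑ˡ 1)) ≡ diffRow j
  row-diff j rewrite splitAt-↑ʳ q (q + 1) (j ↑ˡ 1) | splitAt-↑ˡ q j 1 = refl
  row-weight : row′ (q ↑ʳ (q ↑ʳ zero)) ≡ weightRow
  row-weight rewrite splitAt-↑ʳ q (q + 1) (q ↑ʳ zero) | splitAt-↑ʳ q 1 zero = refl
  zero-tail : ∀ {l} (x : Vec Bool l) n → n + dot x (zeros l) ≡ n
  zero-tail x n = trans (cong (_+_ n) (dot-zerosʳ x)) (+-identityʳ n)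

  detects′ : ∀ x y → (∀ i → dot x (row′ i) ≡ dot y (row′ i)) → x ≡ y
  detects′ x y H with Vec.splitAt k x | Vec.splitAt k y
  ... | a , x₁ , refl | a′ , y₁ , refl with Vec.splitAt k x₁ | Vec.splitAt k y₁
  ... | b , c , refl | b′ , c′ , refl = glue (doubling-recovers D sums diffs weights)
    where
    glue : a ≡ a′ × b ≡ b′ × c ≡ c′ → a ++ b ++ c ≡ a′ ++ b′ ++ c′
    glue (refl , refl , refl) = refl
    H₃ : ∀ i {r s t} → row′ i ≡ r ++ s ++ t → dot a r + (dot b s + dot c t) ≡ dot a′ r + (dot b′ s + dot c′ t)
    H₃ i {r} {s} {t} eq = begin
      dot a r + (dot b s + dot c t)     ≡⟨ dot-++₃ a b c r s t ⟨
      dot (a ++ b ++ c) (r ++ s ++ t)    ≡⟨ subst (λ z → dot (a ++ b ++ c) z ≡ dot (a′ ++ b′ ++ c′) z) eq (H i) ⟩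
      dot (a′ ++ b′ ++ c′) (r ++ s ++ t) ≡⟨ dot-++₃ a′ b′ c′ r s t ⟩
      dot a′ r + (dot b′ s + dot c′ t)  ∎
      where open ≡-Reasoning
    sums : ∀ j → dot a (R j) + dot b (R j) ≡ dot a′ (R j) + dot b′ (R j)
    sums j = begin
      dot a (R j) + dot b (R j)                       ≡⟨ cong (_+_ (dot a (R j))) (zero-tail c _) ⟨
      dot a (R j) + (dot b (R j) + dot c (zeros q))    ≡⟨ H₃ _ (row-sum j) ⟩
      dot a′ (R j) + (dot b′ (R j) + dot c′ (zeros q)) ≡⟨ cong (_+_ (dot a′ (R j))) (zero-tail c′ _) ⟩
      dot a′ (R j) + dot b′ (R j)                     ∎
      where open ≡-Reasoning
    diffs : ∀ j → dot a (R j) + (dot b (complement (R j)) + bit (Vec.lookup c j))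
                ≡ dot a′ (R j) + (dot b′ (complement (R j)) + bit (Vec.lookup c′ j))
    diffs j = begin
      dot a (R j) + (dot b (complement (R j)) + bit (Vec.lookup c j))    ≡⟨ cong (λ z → dot a (R j) + (_ + z)) (dot-unit c j) ⟨
      dot a (R j) + (dot b (complement (R j)) + dot c (unit j))          ≡⟨ H₃ _ (row-diff j) ⟩
      dot a′ (R j) + (dot b′ (complement (R j)) + dot c′ (unit j))       ≡⟨ cong (λ z → dot a′ (R j) + (_ + z)) (dot-unit c′ j) ⟩
      dot a′ (R j) + (dot b′ (complement (R j)) + bit (Vec.lookup c′ j)) ∎
      where open ≡-Reasoning
    weights : weight b ≡ weight b′
    weights = begin
      weight b                                           ≡⟨ zero-tail c (weight b) ⟨
      weight b + dot c (zeros q)                         ≡⟨ cong₂ _+_ (dot-zerosʳ a) refl ⟨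
      dot a (zeros k) + (weight b + dot c (zeros q))     ≡⟨ H₃ _ row-weight ⟩
      dot a′ (zeros k) + (weight b′ + dot c′ (zeros q))  ≡⟨ cong₂ _+_ (dot-zerosʳ a′) (zero-tail c′ (weight b′)) ⟩
      weight b′                                          ∎
      where open ≡-Reasoning

decode : ℕ → ℕ → ℕ → ℕ
decode m a c with a ≤? c
... | yes _ = a
... | no  _ = m ∸ c

decode-≤ : ∀ {m a c} → a ≤ c → decode m a c ≡ a
decode-≤ {m} {a} {c} a≤c with a ≤? c
... | yes _   = refl
... | no  a≰c = ⊥-elim (a≰c a≤c)

decode-> : ∀ {m a c} → c < a → decode m a c ≡ m ∸ c
decode-> {m} {a} {c} c<a with a ≤? c
... | yes a≤c = ⊥-elim (<⇒≱ c<a a≤c)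
... | no  _   = refl

-- h ⊓ (1 + h̄) ≤ h̄ ⊓ (1 + h) exactly when h ≤ h̄, and then the left side is h;
-- otherwise the right side is h̄
decode-⊓ : ∀ h h̄ → decode (h + h̄) (h ⊓ suc h̄) (h̄ ⊓ suc h) ≡ h
decode-⊓ h h̄ with h ≤? h̄
... | yes h≤h̄ = trans (decode-≤ (≤-trans (m⊓n≤m h (suc h̄)) (⊓-glb h≤h̄ (n≤1+n h))))
                      (m≤n⇒m⊓n≡m (m≤n⇒m≤1+n h≤h̄))
... | no  h≰h̄ = trans (decode-> c<a) (trans (cong (_∸_ (h + h̄)) c≡h̄) (m+n∸n≡m h h̄))
  where
  h̄<h : h̄ < h
  h̄<h = ≰⇒> h≰h̄
  c≡h̄ : h̄ ⊓ suc h ≡ h̄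
  c≡h̄ = m≤n⇒m⊓n≡m (≤-trans (<⇒≤ h̄<h) (n≤1+n h))
  c<a : h̄ ⊓ suc h < h ⊓ suc h̄
  c<a = ≤-trans (s≤s (m⊓n≤m h̄ (suc h))) (≤-reflexive (sym (m≥n⇒m⊓n≡n h̄<h)))

foldedDist-complement : ∀ {m} (u y : Vec Bool m) → foldedDist u (complement y) ≡ hamming u (complement y) ⊓ suc (hamming u y)
foldedDist-complement u y = cong (λ z → hamming u (complement y) ⊓ suc (hamming u z)) (complement-involutive y)

hamming-determined : ∀ {m} (u v y : Vec Bool m) →
  foldedDist u y ≡ foldedDist v y → foldedDist u (complement y) ≡ foldedDist v (complement y) →
  hamming u y ≡ hamming v y
hamming-determined {m} u v y e e̅ = trans (sym (recover u)) (trans (cong₂ (decode m) e e̅) (recover v))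
  where
  recover : ∀ u → decode m (foldedDist u y) (foldedDist u (complement y)) ≡ hamming u y
  recover u = trans (cong₂ (λ s c → decode s (foldedDist u y) c)
                           (sym (hamming+hamming-complement u y)) (foldedDist-complement u y))
                    (decode-⊓ (hamming u y) (hamming u (complement y)))

resolving-if-determined : ∀ n (S : List (Vec Bool (n ∸ 1))) →
  (∀ u v → (∀ y → y ∈ S → dF n u y ≡ dF n v y) → u ≡ v) → Resolving n S
resolving-if-determined n S determined u v u≢v with any? (λ y → ¬? (dF n u y ≟ dF n v y)) S
... | yes sep = find sep
... | no ¬sep = ⊥-elim (u≢v (determined u v λ y y∈S →
                  decidable-stable (dF n u y ≟ dF n v y) (¬sep ∘ lose y∈S)))

module _ {m q} (D : Detecting m q) where

  probes : List (Vec Bool m)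
  probes = zeros m ∷ List.tabulate (row D)

  detectingSet : List (Vec Bool m)
  detectingSet = probes List.++ List.map complement probes

  length-detectingSet : length detectingSet ≡ suc q + suc q
  length-detectingSet =
    trans (length-++ probes) (cong₂ _+_ |probes| (trans (length-map complement probes) |probes|))
    where
    |probes| : length probes ≡ suc q
    |probes| = cong suc (length-tabulate (row D))

  -- distances to y and ȳ give |u ⊕ y|; for y = 0 this is |u|, and then
  -- |u ⊕ y| = |u| + |y| - 2 u·y gives the weighings u·y
  detectingSet-resolving : Resolving (suc m) detectingSet
  detectingSet-resolving = resolving-if-determined (suc m) detectingSet λ u v same →
    detects D u v (dots-equal u v same)
    where
    dots-equal : ∀ u v → (∀ y → y ∈ detectingSet → dF (suc m) u y ≡ dF (suc m) v y) →
                 ∀ i → dot u (row D i) ≡ dot v (row D i)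
    dots-equal u v same i = *-cancelˡ-≡ _ _ 2 (+-cancelˡ-≡ (hamming u (row D i)) _ _ (begin
      hamming u (row D i) + 2 * dot u (row D i) ≡⟨ hamming+2*dot u (row D i) ⟩
      weight u + weight (row D i)              ≡⟨ cong (_+ weight (row D i)) weights ⟩
      weight v + weight (row D i)              ≡⟨ hamming+2*dot v (row D i) ⟨
      hamming v (row D i) + 2 * dot v (row D i) ≡⟨ cong (_+ 2 * dot v (row D i)) (hammings (row D i) (there (∈-tabulate⁺ i))) ⟨
      hamming u (row D i) + 2 * dot v (row D i) ∎))
      where
      open ≡-Reasoning
      sameFolded : ∀ y → y ∈ detectingSet → foldedDist u y ≡ foldedDist v y
      sameFolded y y∈ = trans (sym (dF≡foldedDist u y)) (trans (same y y∈) (dF≡foldedDist v y))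
      hammings : ∀ y → y ∈ probes → hamming u y ≡ hamming v y
      hammings y y∈ = hamming-determined u v y (sameFolded y (∈-++⁺ˡ y∈))
                        (sameFolded (complement y) (∈-++⁺ʳ probes (∈-map⁺ complement y∈)))
      weights : weight u ≡ weight v
      weights = trans (sym (hamming-zeros u)) (trans (hammings (zeros m) (here refl)) (hamming-zeros v))

-- Metric dimension is O(n / log n)

coins weighings : ℕ → ℕ
coins     zero    = 1
coins     (suc t) = coins t + (coins t + weighings t)
weighings zero    = 1
weighings (suc t) = weighings t + (weighings t + 1)

detecting : ∀ t → Detecting (coins t) (weighings t)
detecting zero    = detecting-1
detecting (suc t) = detecting-double (detecting t)

detecting-≤ : ∀ {m} t → m ≤ coins t → Detecting m (weighings t)
detecting-≤ {m} t m≤ with m≤n⇒∃[o]m+o≡n m≤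
... | o , m+o≡ = detecting-restrict (subst (λ k → Detecting k (weighings t)) (sym m+o≡) (detecting t))

t<coins : ∀ t → t < coins t
t<coins zero    = s≤s z≤n
t<coins (suc t) = +-mono-≤ (≤-trans (s≤s z≤n) (t<coins t)) (≤-trans (t<coins t) (m≤m+n (coins t) (weighings t)))

1+weighings-suc : ∀ t → suc (weighings (suc t)) ≡ 2 * suc (weighings t)
1+weighings-suc t = lemma (weighings t)
  where
  lemma : ∀ w → suc (w + (w + 1)) ≡ 2 * suc w
  lemma = ℕ-Solver.solve-∀

t*[1+weighings]+2≡2*coins : ∀ t → t * suc (weighings t) + 2 ≡ 2 * coins t
t*[1+weighings]+2≡2*coins zero    = refl
t*[1+weighings]+2≡2*coins (suc t) = +-cancelʳ-≡ 2 _ _ (begin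
  suc t * suc (weighings (suc t)) + 2 + 2  ≡⟨ cong (λ z → suc t * z + 2 + 2) (1+weighings-suc t) ⟩
  suc t * (2 * P) + 2 + 2                  ≡⟨ expand t P ⟩
  2 * (t * P + 2) + 2 * P                  ≡⟨ cong (λ z → 2 * z + 2 * P) (t*[1+weighings]+2≡2*coins t) ⟩
  2 * (2 * coins t) + 2 * P                ≡⟨ collect (coins t) (weighings t) ⟩
  2 * coins (suc t) + 2                    ∎)
  where
  open ≡-Reasoning
  P = suc (weighings t)
  expand : ∀ t P → suc t * (2 * P) + 2 + 2 ≡ 2 * (t * P + 2) + 2 * P
  expand = ℕ-Solver.solve-∀
  collect : ∀ K w → 2 * (2 * K) + 2 * suc w ≡ 2 * (K + (K + w)) + 2
  collect = ℕ-Solver.solve-∀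

bracket : ∀ (f : ℕ → ℕ) → (∀ t → t < f t) → ∀ {m t₀} → f t₀ ≤ m → ∃[ t ] (t₀ ≤ t × f t ≤ m × m < f (suc t))
bracket f t<f {m} {t₀} f≤m = search m t₀ f≤m (m≤m+n m t₀)
  where
  search : ∀ fuel t → f t ≤ m → m ≤ fuel + t → ∃[ t′ ] (t ≤ t′ × f t′ ≤ m × m < f (suc t′))
  search fuel t ft≤m m≤ with m <? f (suc t)
  ... | yes m< = t , ≤-refl , ft≤m , m<
  search zero       t _ m≤t | no m≮ = ⊥-elim (m≮ (≤-trans (s≤s m≤t) (<⇒≤ (t<f (suc t)))))
  search (suc fuel) t _ m≤  | no m≮ with search fuel (suc t) (≮⇒≥ m≮) (≤-trans m≤ (≤-reflexive (sym (+-suc fuel t))))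
  ... | t′ , t<t′ , ft′≤m , m<ft′ = t′ , ≤-trans (n≤1+n t) t<t′ , ft′≤m , m<ft′

t*β≤8m : ∀ t₀ {m b} → coins t₀ ≤ m → IsMetricDim (suc m) b → t₀ * b ≤ 8 * m
t*β≤8m t₀ {m} {b} c≤m β with bracket coins t<coins {m} {t₀} c≤m
... | t , t₀≤t , ct≤m , m<c = begin
  t₀ * b        ≤⟨ *-mono-≤ t₀≤t b≤4P ⟩
  t * (4 * P)   ≡⟨ swap t P ⟩
  4 * (t * P)   ≤⟨ *-monoʳ-≤ 4 tP≤2m ⟩
  4 * (2 * m)   ≡⟨ *-assoc 4 2 m ⟨
  8 * m         ∎
  where
  open ≤-Reasoning
  P = suc (weighings t)
  D : Detecting m (weighings (suc t))
  D = detecting-≤ (suc t) (<⇒≤ m<c)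
  swap : ∀ t P → t * (4 * P) ≡ 4 * (t * P)
  swap = ℕ-Solver.solve-∀
  b≤4P : b ≤ 4 * P
  b≤4P = begin
    b                                                ≤⟨ IsMinSize-≤-length (≡-dec Bool._≟_) (resolving-mono (suc m)) β
                                                          (detectingSet-resolving D) ⟩
    length (detectingSet D)                          ≡⟨ length-detectingSet D ⟩
    suc (weighings (suc t)) + suc (weighings (suc t)) ≡⟨ cong₂ _+_ (1+weighings-suc t) (1+weighings-suc t) ⟩
    2 * P + 2 * P                                    ≡⟨ *-distribʳ-+ P 2 2 ⟨
    4 * P                                            ∎
  tP≤2m : t * P ≤ 2 * m
  tP≤2m = ≤-trans (m≤m+n (t * P) 2) (≤-trans (≤-reflexive (t*[1+weighings]+2≡2*coins t)) (*-monoʳ-≤ 2 ct≤m))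

2*Q*β≤m : ∀ Q {m b} → coins (16 * Q) ≤ m → IsMetricDim (suc m) b → 2 * (Q * b) ≤ m
2*Q*β≤m Q {m} {b} c≤m β = *-cancelˡ-≤ 8 (≤-trans (≤-reflexive (regroup Q b)) (t*β≤8m (16 * Q) c≤m β))
  where
  regroup : ∀ Q b → 8 * (2 * (Q * b)) ≡ 16 * Q * b
  regroup = ℕ-Solver.solve-∀

∣a-n/D∣≤ε*n : ∀ a n e D′ P Q′ .(c : Coprime P (suc Q′)) →
  a * suc D′ ≡ n + e → e * suc Q′ ≤ P * n * suc D′ →
  ℚ.∣ toℚ a ℚ.- (+ n) ℚ./ suc D′ ∣ ℚ.≤ mkℚ (+ P) Q′ c ℚ.* toℚ n
∣a-n/D∣≤ε*n a n e D′ P Q′ c aD≡n+e eQ≤PnD = subst (ℚ._≤ ε ℚ.* toℚ n) (sym (ℚP.0≤p⇒∣p∣≡p 0≤x)) x≤εn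
  where
  D = suc D′
  ε = mkℚ (+ P) Q′ c
  x = toℚ a ℚ.- (+ n) ℚ./ D
  cross : (+ a ℤ.* + D ℤ.+ ℤ.- (+ n) ℤ.* + 1) ℤ.* + D ≡ + e ℤ.* + (1 * D)
  cross = begin
    (+ a ℤ.* + D ℤ.+ ℤ.- (+ n) ℤ.* + 1) ℤ.* + D  ≡⟨ cong (λ z → (z ℤ.+ ℤ.- (+ n) ℤ.* + 1) ℤ.* + D) aD ⟩
    (+ n ℤ.+ + e ℤ.+ ℤ.- (+ n) ℤ.* + 1) ℤ.* + D  ≡⟨ cancel (+ n) (+ e) (+ D) ⟩
    + e ℤ.* + D                                  ≡⟨ cong (λ z → + e ℤ.* + z) (*-identityˡ D) ⟨
    + e ℤ.* + (1 * D)                            ∎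
    where
    open ≡-Reasoning
    aD : + a ℤ.* + D ≡ + n ℤ.+ + e
    aD = trans (sym (ℤP.pos-* a D)) (trans (cong +_ aD≡n+e) (ℤP.pos-+ n e))
    cancel : ∀ N E D → (N ℤ.+ E ℤ.+ ℤ.- N ℤ.* ℤ.1ℤ) ℤ.* D ≡ E ℤ.* D
    cancel = ℤ-Solver.solve-∀
  x≃e/D : ℚ.toℚᵘ x ℚᵘ.≃ mkℚᵘ (+ e) D′
  x≃e/D = ℚᵘP.≃-trans (ℚP.toℚᵘ-homo-+ (toℚ a) (ℚ.- ((+ n) ℚ./ D)))
            (ℚᵘP.≃-trans (ℚᵘP.+-cong (ℚP.toℚᵘ-fromℚᵘ (mkℚᵘ (+ a) 0))
                                    (ℚᵘP.≃-trans (ℚP.toℚᵘ-homo‿- ((+ n) ℚ./ D))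
                                                 (ℚᵘP.-‿cong (ℚP.toℚᵘ-fromℚᵘ (mkℚᵘ (+ n) D′)))))
                         (*≡* cross))
  0≤x : ℚ.0ℚ ℚ.≤ x
  0≤x = ℚP.toℚᵘ-cancel-≤ (ℚᵘP.≤-respʳ-≃ (ℚᵘP.≃-sym x≃e/D)
          (*≤* (subst₂ ℤ._≤_ (sym (ℤP.*-zeroˡ (+ D))) (sym (ℤP.*-identityʳ (+ e))) (ℤ.+≤+ z≤n))))
  εn≃ : ℚ.toℚᵘ (ε ℚ.* toℚ n) ℚᵘ.≃ mkℚᵘ (+ P) Q′ ℚᵘ.* mkℚᵘ (+ n) 0
  εn≃ = ℚᵘP.≃-trans (ℚP.toℚᵘ-homo-* ε (toℚ n))
                    (ℚᵘP.*-cong (ℚᵘP.≃-refl {mkℚᵘ (+ P) Q′}) (ℚP.toℚᵘ-fromℚᵘ (mkℚᵘ (+ n) 0)))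
  x≤εn : x ℚ.≤ ε ℚ.* toℚ n
  x≤εn = ℚP.toℚᵘ-cancel-≤
           (ℚᵘP.≤-respˡ-≃ (ℚᵘP.≃-sym x≃e/D) (ℚᵘP.≤-respʳ-≃ (ℚᵘP.≃-sym εn≃) (*≤* cross′)))
    where
    cross′ : + e ℤ.* + (suc Q′ * 1) ℤ.≤ (+ P ℤ.* + n) ℤ.* + D
    cross′ = begin
      + e ℤ.* + (suc Q′ * 1)  ≡⟨ ℤP.pos-* e _ ⟨
      + (e * (suc Q′ * 1))    ≡⟨ cong (λ z → + (e * z)) (*-identityʳ (suc Q′)) ⟩
      + (e * suc Q′)          ≤⟨ ℤ.+≤+ eQ≤PnD ⟩
      + (P * n * D)           ≡⟨ ℤP.pos-* (P * n) D ⟩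
      + (P * n) ℤ.* + D       ≡⟨ cong (ℤ._* + D) (ℤP.pos-* P n) ⟩
      (+ P ℤ.* + n) ℤ.* + D   ∎
      where open ℤP.≤-Reasoning

littleO-intro : ∀ {P : ℕ → Set} {f g : ℕ → ℚ} →
  (∀ P′ Q′ .(c : Coprime (suc P′) (suc Q′)) →
     ∃[ N ] (∀ n → N ≤ n → P n → ℚ.∣ f n ℚ.- g n ∣ ℚ.≤ mkℚ (+ suc P′) Q′ c ℚ.* toℚ n)) →
  EqPlusLittleO P f g
littleO-intro bound (mkℚ (+ zero)   Q′ c) 0<ε = ⊥-elim (ℤ.Positive.pos (ℚ.positive 0<ε))
littleO-intro bound (mkℚ (+ suc P′) Q′ c) _   = bound P′ Q′ c
littleO-intro bound (mkℚ -[1+ k ]   Q′ c) 0<ε = ⊥-elim (ℤ.Positive.pos (ℚ.positive 0<ε))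

m*2≡m+m : ∀ m → m * 2 ≡ m + m
m*2≡m+m = ℕ-Solver.solve-∀

odd⇒≡1+2*half : ∀ n → n % 2 ≡ 1 → n ≡ suc (n / 2 + n / 2)
odd⇒≡1+2*half n odd = trans (m≡m%n+[m/n]*n n 2) (cong₂ _+_ odd (m*2≡m+m (n / 2)))

even⇒≡2*half : ∀ n → n % 2 ≡ 0 → n ≡ n / 2 + n / 2
even⇒≡2*half n even = trans (m≡m%n+[m/n]*n n 2) (cong₂ _+_ even (m*2≡m+m (n / 2)))

[2+2r]/2≡1+r : ∀ r → suc (suc (r + r)) / 2 ≡ suc r
[2+2r]/2≡1+r r = trans (cong (_/ 2) (sym (*2≡ r))) (m*n/n≡m (suc r) 2)
  where
  *2≡ : ∀ r → suc r * 2 ≡ suc (suc (r + r))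
  *2≡ = ℕ-Solver.solve-∀

Ψ≤β+[n+1]/2 : ∀ n {b p} → n % 2 ≡ 1 → IsMetricDim n b → IsDoubleMetricDim n p → p ≤ b + suc n / 2
Ψ≤β+[n+1]/2 n odd β ψ with n / 2 | odd⇒≡1+2*half n odd
... | r | refl rewrite [2+2r]/2≡1+r r = Ψ[1+2r]≤β+1+r r β ψ

β+[n+1]/2≈n/2 : (β : ℕ → ℕ) → (∀ n → IsMetricDim n (β n)) →
  EqPlusLittleO (λ n → n % 2 ≡ 1) (λ n → toℚ (β n + suc n / 2)) (λ n → (+ n) ℚ./ 2)
β+[n+1]/2≈n/2 β β-dim =
  littleO-intro {f = λ n → toℚ (β n + suc n / 2)} {g = λ n → (+ n) ℚ./ 2} λ P′ Q′ c →
    suc (coins (16 * suc Q′) + suc Q′) , estimate P′ Q′ c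
  where
  estimate : ∀ P′ Q′ .(c : Coprime (suc P′) (suc Q′)) n → suc (coins (16 * suc Q′) + suc Q′) ≤ n → n % 2 ≡ 1 →
    ℚ.∣ toℚ (β n + suc n / 2) ℚ.- (+ n) ℚ./ 2 ∣ ℚ.≤ mkℚ (+ suc P′) Q′ c ℚ.* toℚ n
  estimate P′ Q′ c (suc m) (s≤s N≤m) odd with m | suc m / 2 | odd⇒≡1+2*half (suc m) odd
  ... | _ | r | refl rewrite [2+2r]/2≡1+r r =
    ∣a-n/D∣≤ε*n (b + suc r) n (suc (2 * b)) 1 (suc P′) Q′ c (excess b r) (begin
      suc (2 * b) * Q            ≡⟨ expand b Q ⟩
      Q + 2 * (Q * b)            ≤⟨ +-mono-≤ Q≤2r (2*Q*β≤m Q (≤-trans (m≤m+n _ Q) N≤m) (β-dim n)) ⟩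
      (r + r) + (r + r)          ≤⟨ m≤m+n _ (P′ * n * 2) ⟩
      (r + r) + (r + r) + P′ * n * 2
        ≤⟨ +-monoˡ-≤ (P′ * n * 2) (≤-trans (+-mono-≤ (n≤1+n _) (n≤1+n _)) (≤-reflexive (sym (m*2≡m+m n)))) ⟩
      n * 2 + P′ * n * 2         ≡⟨ collect P′ n ⟩
      suc P′ * n * 2             ∎)
    where
    open ≤-Reasoning
    n = suc (r + r)
    b = β n
    Q = suc Q′
    Q≤2r : Q ≤ r + r
    Q≤2r = ≤-trans (m≤n+m Q _) N≤m
    excess : ∀ b r → (b + suc r) * 2 ≡ suc (r + r) + suc (2 * b)
    excess = ℕ-Solver.solve-∀
    expand : ∀ b Q → suc (2 * b) * Q ≡ Q + 2 * (Q * b)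
    expand = ℕ-Solver.solve-∀
    collect : ∀ P′ n → n * 2 + P′ * n * 2 ≡ suc P′ * n * 2
    collect = ℕ-Solver.solve-∀

Ψ≤β+n∸1 : ∀ n {b p} → 2 ≤ n → n % 2 ≡ 0 → IsMetricDim n b → IsDoubleMetricDim n p → p ≤ b + (n ∸ 1)
Ψ≤β+n∸1 (suc (suc k)) (s≤s (s≤s _)) even = Ψ[2+k]≤β+1+k k (suc (suc k) / 2) (even⇒≡2*half (suc (suc k)) even)

β+n∸1≈n : (β : ℕ → ℕ) → (∀ n → IsMetricDim n (β n)) →
  EqPlusLittleO (λ n → n % 2 ≡ 0) (λ n → toℚ (β n + (n ∸ 1))) (λ n → toℚ n)
β+n∸1≈n β β-dim =
  littleO-intro {f = λ n → toℚ (β n + (n ∸ 1))} {g = toℚ} λ P′ Q′ c →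
    suc (coins (16 * suc Q′) + suc Q′) , estimate P′ Q′ c
  where
  estimate : ∀ P′ Q′ .(c : Coprime (suc P′) (suc Q′)) n → suc (coins (16 * suc Q′) + suc Q′) ≤ n → n % 2 ≡ 0 →
    ℚ.∣ toℚ (β n + (n ∸ 1)) ℚ.- toℚ n ∣ ℚ.≤ mkℚ (+ suc P′) Q′ c ℚ.* toℚ n
  estimate P′ Q′ c (suc zero) (s≤s N≤0) _ =
    ⊥-elim (<⇒≱ (≤-trans (≤-trans (s≤s z≤n) (t<coins (16 * suc Q′))) (m≤m+n _ (suc Q′))) N≤0)
  estimate P′ Q′ c (suc (suc k)) (s≤s N≤m) _ = bound (β n) (β-dim n)
    where
    n = suc (suc k)
    Q = suc Q′
    bound : ∀ b → IsMetricDim n b → ℚ.∣ toℚ (b + suc k) ℚ.- toℚ n ∣ ℚ.≤ mkℚ (+ suc P′) Q′ c ℚ.* toℚ n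
    bound zero     dim with () ← 1≤β dim
    bound (suc b′) dim = ∣a-n/D∣≤ε*n (suc b′ + suc k) n b′ 0 (suc P′) Q′ c (excess b′ k) (begin
      b′ * Q              ≡⟨ *-comm b′ Q ⟩
      Q * b′              ≤⟨ m≤n+m _ Q ⟩
      Q + Q * b′          ≡⟨ *-suc Q b′ ⟨
      Q * suc b′          ≤⟨ m≤n*m _ 2 ⟩
      2 * (Q * suc b′)    ≤⟨ 2*Q*β≤m Q (≤-trans (m≤m+n _ Q) N≤m) dim ⟩
      suc k               ≤⟨ n≤1+n _ ⟩
      n                   ≤⟨ m≤m+n n (P′ * n) ⟩
      n + P′ * n          ≡⟨ collect P′ n ⟩
      suc P′ * n * 1      ∎)
      where
      open ≤-Reasoning
      excess : ∀ b′ k → (suc b′ + suc k) * 1 ≡ suc (suc k) + b′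
      excess = ℕ-Solver.solve-∀
      collect : ∀ P′ n → n + P′ * n ≡ suc P′ * n * 1
      collect = ℕ-Solver.solve-∀

theorem11 :
    ((n : ℕ) → 3 ≤ n → n % 2 ≡ 1 → (b p : ℕ) → IsMetricDim n b → IsDoubleMetricDim n p →
        p ≤ b + (suc n / 2))
    × ((β : ℕ → ℕ) → ((n : ℕ) → IsMetricDim n (β n)) →
        EqPlusLittleO (λ n → n % 2 ≡ 1)
          (λ n → toℚ (β n + (suc n / 2)))
          (λ n → (+ n) ℚ./ 2))
    × ((n : ℕ) → 2 ≤ n → n % 2 ≡ 0 → (b p : ℕ) → IsMetricDim n b → IsDoubleMetricDim n p →
        p ≤ b + (n ∸ 1))
    × ((β : ℕ → ℕ) → ((n : ℕ) → IsMetricDim n (β n)) →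
        EqPlusLittleO (λ n → n % 2 ≡ 0)
          (λ n → toℚ (β n + (n ∸ 1)))
          (λ n → toℚ n))
theorem11 =
  (λ n _ odd b p → Ψ≤β+[n+1]/2 n odd) ,
  β+[n+1]/2≈n/2 ,
  (λ n 2≤n even b p → Ψ≤β+n∸1 n 2≤n even) ,
  β+n∸1≈n
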